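{- Every non-trivial misère quotient $(\mathcal{Q},\mathcal{P})$ contains an element $a\neq 1$ with $a^2=1$ (where $1$ is the identity of $\mathcal{Q}$).
   Context: All games are impartial; $G+H$ is the disjunctive sum. In misère play the last player to move loses; $o^-(G)$ is the misère outcome. A set $\mathscr{A}$ of games is closed if it is closed under sums and under taking options. For closed $\mathscr{A}$, $G\equiv_{\mathscr{A}}H$ iff $o^-(G+X)=o^-(H+X)$ for all $X\in\mathscr{A}$; the misère quotient is $(\mathcal{Q},\mathcal{P})$ with $\mathcal{Q}=\mathscr{A}/\equiv_{\mathscr{A}}$ and $\mathcal{P}$ the set of classes of misère $\mathscr{P}$-positions. It is non-trivial if $\mathscr{A}\neq\{0\}$. -}

module Defs where

open import Level using (Level)
open import Data.List using (List; []; _∷_; _++_)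
open import Data.List.Membership.Propositional using (_∈_)
open import Data.Product using (Σ; _×_; ∃)
open import Relation.Nullary using (¬_)
open import Relation.Binary.PropositionalEquality using (_≡_)

-- Short impartial games: a game is given by its (finite) list of options.
data Game : Set where
  mk : List Game → Game

options : Game → List Game
options (mk gs) = gs

𝟘 : Game
𝟘 = mk []

infixl 6 _⊕_
mutual
  _⊕_ : Game → Game → Game
  mk gs ⊕ mk hs = mk (leftMoves gs (mk hs) ++ rightMoves (mk gs) hs)

  leftMoves : List Game → Game → List Game
  leftMoves [] h = []
  leftMoves (g ∷ gs) h = (g ⊕ h) ∷ leftMoves gs h

  rightMoves : Game → List Game → List Game
  rightMoves g [] = []
  rightMoves g (h ∷ hs) = (g ⊕ h) ∷ rightMoves g hs

data Outcome : Set where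
  𝒩 𝒫 : Outcome

-- Misère play: a game with no options is an 𝒩-position (the player to move
-- cannot move, so the opponent moved last and loses); otherwise the game is a
-- 𝒫-position iff every option is an 𝒩-position.
mutual
  o⁻ : Game → Outcome
  o⁻ (mk []) = 𝒩
  o⁻ (mk (g ∷ gs)) = allN (g ∷ gs)

  allN : List Game → Outcome
  allN [] = 𝒫
  allN (g ∷ gs) with o⁻ g
  ... | 𝒫 = 𝒩
  ... | 𝒩 = allN gs

record Closed {ℓ : Level} (𝒜 : Game → Set ℓ) : Set ℓ where
  field
    sum-closed    : ∀ G H → 𝒜 G → 𝒜 H → 𝒜 (G ⊕ H)
    option-closed : ∀ G → 𝒜 G → ∀ G′ → G′ ∈ options G → 𝒜 G′

NonTrivial : {ℓ : Level} → (Game → Set ℓ) → Set ℓ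
NonTrivial 𝒜 = Σ Game λ G → 𝒜 G × ¬ (G ≡ 𝟘)

-- Indistinguishability modulo 𝒜 (the congruence defining the misère quotient).
_≡[_]_ : {ℓ : Level} → Game → (Game → Set ℓ) → Game → Set ℓ
G ≡[ 𝒜 ] H = ∀ X → 𝒜 X → o⁻ (G ⊕ X) ≡ o⁻ (H ⊕ X)

{-# OPTIONS --safe #-}

-- Below every nonzero game of 𝒜 there is a follower all of whose options
-- are 0, i.e. a copy of * (possibly with repeated options); by option-closure
-- it lies in 𝒜 together with 0. In misère play * is a 𝒫-position while 0 is
-- an 𝒩-position, so * ≢ 0. And * + * ≡ 0 even against arbitrary games X:
-- every move in a * component leads to * + X, which is 𝒩 whenever X is 𝒫, so
-- by induction on X the outcome of * + * + X is that of X.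

module Submission where

open import Defs
open import Level using (Level)
open import Data.Empty using (⊥-elim)
open import Data.List using (List; []; _∷_; _++_; map)
open import Data.List.Properties using (map-id-local; ++-identityʳ)
open import Data.List.Relation.Unary.All as All using (All; []; _∷_)
open import Data.List.Relation.Unary.All.Properties using (++⁺; map⁺; ¬All⇒Any¬)
open import Data.List.Relation.Unary.Any using (Any; here; there)
open import Data.List.Membership.Propositional using (_∈_; find; lose)
open import Data.List.Membership.Propositional.Properties using (∈-map⁺; ∈-++⁺ˡ; ∈-++⁺ʳ)
open import Data.Product using (Σ; ∃-syntax; _×_; _,_)
open import Data.Sum using (_⊎_; inj₁; inj₂)
open import Relation.Nullary using (¬_; Dec; yes; no)
open import Relation.Binary.PropositionalEquality
  using (_≡_; _≢_; refl; sym; trans; cong; cong₂; subst; module ≡-Reasoning)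

private
  variable
    ℓ : Level
    G G′ O X : Game
    gs : List Game

Game-induction : (Q : Game → Set ℓ) → (∀ G → All Q (options G) → Q G) → ∀ G → Q G
Game-induction Q step = induct
  where
  mutual
    induct : ∀ G → Q G
    induct (mk gs) = step (mk gs) (induct-all gs)

    induct-all : ∀ gs → All Q gs
    induct-all []       = []
    induct-all (g ∷ gs) = induct g ∷ induct-all gs

_≟𝟘 : (G : Game) → Dec (G ≡ 𝟘)
mk []      ≟𝟘 = yes refl
mk (_ ∷ _) ≟𝟘 = no λ ()

leftMoves-map : ∀ gs H → leftMoves gs H ≡ map (_⊕ H) gs
leftMoves-map []       H = refl
leftMoves-map (g ∷ gs) H = cong (g ⊕ H ∷_) (leftMoves-map gs H)

rightMoves-map : ∀ G hs → rightMoves G hs ≡ map (G ⊕_) hs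
rightMoves-map G []       = refl
rightMoves-map G (h ∷ hs) = cong (G ⊕ h ∷_) (rightMoves-map G hs)

options-⊕ : ∀ G H → options (G ⊕ H) ≡ map (_⊕ H) (options G) ++ map (G ⊕_) (options H)
options-⊕ (mk gs) (mk hs) = cong₂ _++_ (leftMoves-map gs (mk hs)) (rightMoves-map (mk gs) hs)

∈-options-⊕ˡ : ∀ G H → G′ ∈ options G → G′ ⊕ H ∈ options (G ⊕ H)
∈-options-⊕ˡ G H G′∈ =
  subst (_ ∈_) (sym (options-⊕ G H)) (∈-++⁺ˡ (∈-map⁺ (_⊕ H) G′∈))

∈-options-⊕ʳ : ∀ {H′} G H → H′ ∈ options H → G ⊕ H′ ∈ options (G ⊕ H)
∈-options-⊕ʳ G H H′∈ =
  subst (_ ∈_) (sym (options-⊕ G H)) (∈-++⁺ʳ _ (∈-map⁺ (G ⊕_) H′∈))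

All-options-⊕ : ∀ {Q : Game → Set ℓ} G H →
  All (λ g → Q (g ⊕ H)) (options G) → All (λ h → Q (G ⊕ h)) (options H) →
  All Q (options (G ⊕ H))
All-options-⊕ G H left right =
  subst (All _) (sym (options-⊕ G H)) (++⁺ (map⁺ left) (map⁺ right))

⊕-identityˡ : ∀ G → 𝟘 ⊕ G ≡ G
⊕-identityˡ = Game-induction (λ G → 𝟘 ⊕ G ≡ G) step
  where
  step : ∀ G → All (λ g → 𝟘 ⊕ g ≡ g) (options G) → 𝟘 ⊕ G ≡ G
  step (mk gs) ih = cong mk (trans (rightMoves-map 𝟘 gs) (map-id-local ih))

⊕-identityʳ : ∀ G → G ⊕ 𝟘 ≡ G
⊕-identityʳ = Game-induction (λ G → G ⊕ 𝟘 ≡ G) step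
  where
  open ≡-Reasoning
  step : ∀ G → All (λ g → g ⊕ 𝟘 ≡ g) (options G) → G ⊕ 𝟘 ≡ G
  step (mk gs) ih = cong mk (begin
    options (mk gs ⊕ 𝟘)   ≡⟨ options-⊕ (mk gs) 𝟘 ⟩
    map (_⊕ 𝟘) gs ++ []   ≡⟨ ++-identityʳ _ ⟩
    map (_⊕ 𝟘) gs         ≡⟨ map-id-local ih ⟩
    gs                    ∎)

Is𝒫 Is𝒩 : Game → Set
Is𝒫 G = o⁻ G ≡ 𝒫
Is𝒩 G = o⁻ G ≡ 𝒩

outcome-≡ : ∀ {a b : Outcome} → (b ≡ 𝒫 → a ≡ 𝒫) → (b ≡ 𝒩 → a ≡ 𝒩) → a ≡ b
outcome-≡ {b = 𝒫} if𝒫 if𝒩 = if𝒫 refl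
outcome-≡ {b = 𝒩} if𝒫 if𝒩 = if𝒩 refl

allN-𝒫 : All Is𝒩 gs → allN gs ≡ 𝒫
allN-𝒫 []               = refl
allN-𝒫 (g𝒩 ∷ gs𝒩) rewrite g𝒩 = allN-𝒫 gs𝒩

allN-𝒫⁻ : ∀ gs → allN gs ≡ 𝒫 → All Is𝒩 gs
allN-𝒫⁻ []       _ = []
allN-𝒫⁻ (g ∷ gs) e with o⁻ g in g-outcome
allN-𝒫⁻ (g ∷ gs) () | 𝒫
... | 𝒩 = g-outcome ∷ allN-𝒫⁻ gs e

allN-𝒩 : Any Is𝒫 gs → allN gs ≡ 𝒩
allN-𝒩 (here g𝒫) rewrite g𝒫 = refl
allN-𝒩 {g ∷ _} (there gs𝒫) with o⁻ g
... | 𝒫 = refl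
... | 𝒩 = allN-𝒩 gs𝒫

allN-𝒩⁻ : ∀ gs → allN gs ≡ 𝒩 → Any Is𝒫 gs
allN-𝒩⁻ []       ()
allN-𝒩⁻ (g ∷ gs) e with o⁻ g in g-outcome
... | 𝒫 = here g-outcome
... | 𝒩 = there (allN-𝒩⁻ gs e)

𝒫-intro : ∀ G → G′ ∈ options G → All Is𝒩 (options G) → Is𝒫 G
𝒫-intro (mk (_ ∷ _)) _ = allN-𝒫

𝒫-elim : ∀ G → Is𝒫 G → All Is𝒩 (options G)
𝒫-elim (mk (g ∷ gs)) = allN-𝒫⁻ (g ∷ gs)

𝒩-intro : ∀ G → Any Is𝒫 (options G) → Is𝒩 G
𝒩-intro (mk (_ ∷ _)) = allN-𝒩

𝒩-elim : ∀ G → Is𝒩 G → G ≡ 𝟘 ⊎ Any Is𝒫 (options G)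
𝒩-elim (mk [])       _ = inj₁ refl
𝒩-elim (mk (g ∷ gs)) e = inj₂ (allN-𝒩⁻ (g ∷ gs) e)

record IsStar (O : Game) : Set where
  field
    𝟘-option  : 𝟘 ∈ options O
    options-𝟘 : All (_≡ 𝟘) (options O)

open IsStar

star-𝒫 : IsStar O → Is𝒫 O
star-𝒫 {O} ⋆ = 𝒫-intro O (𝟘-option ⋆) (All.map (λ { refl → refl }) (options-𝟘 ⋆))

∈-options-star⊕ : IsStar O → ∀ H → H ∈ options (O ⊕ H)
∈-options-star⊕ {O} ⋆ H =
  subst (_∈ options (O ⊕ H)) (⊕-identityˡ H) (∈-options-⊕ˡ O H (𝟘-option ⋆))

star-move : IsStar O → Is𝒫 X → Is𝒩 (O ⊕ X)
star-move {O} {X} ⋆ X𝒫 = 𝒩-intro (O ⊕ X) (lose (∈-options-star⊕ ⋆ X) X𝒫)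

options-star⊕star : IsStar O → All (_≡ O) (options (O ⊕ O))
options-star⊕star {O} ⋆ = All-options-⊕ O O
  (All.map (λ { refl → ⊕-identityˡ O }) (options-𝟘 ⋆))
  (All.map (λ { refl → ⊕-identityʳ O }) (options-𝟘 ⋆))

star⊕star-cancel : IsStar O → ∀ X → o⁻ (O ⊕ O ⊕ X) ≡ o⁻ X
star⊕star-cancel {O} ⋆ = Game-induction (λ X → o⁻ (W ⊕ X) ≡ o⁻ X) step
  where
  W : Game
  W = O ⊕ O

  W-𝒩 : Is𝒩 W
  W-𝒩 = 𝒩-intro W (lose (∈-options-star⊕ ⋆ O) (star-𝒫 ⋆))

  step : ∀ X → All (λ x → o⁻ (W ⊕ x) ≡ o⁻ x) (options X) → o⁻ (W ⊕ X) ≡ o⁻ X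
  step X ih = outcome-≡ 𝒫-case 𝒩-case
    where
    𝒫-case : Is𝒫 X → Is𝒫 (W ⊕ X)
    𝒫-case X𝒫 = 𝒫-intro (W ⊕ X) (∈-options-⊕ˡ W X (∈-options-star⊕ ⋆ O))
      (All-options-⊕ W X moves-in-W moves-in-X)
      where
      moves-in-W : All (λ w → Is𝒩 (w ⊕ X)) (options W)
      moves-in-W = All.map (λ { refl → star-move ⋆ X𝒫 }) (options-star⊕star ⋆)

      moves-in-X : All (λ x → Is𝒩 (W ⊕ x)) (options X)
      moves-in-X = All.zipWith (λ (same , x𝒩) → trans same x𝒩) (ih , 𝒫-elim X X𝒫)

    𝒩-case : Is𝒩 X → Is𝒩 (W ⊕ X)
    𝒩-case X𝒩 with 𝒩-elim X X𝒩
    ... | inj₁ refl = trans (cong o⁻ (⊕-identityʳ W)) W-𝒩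
    ... | inj₂ some𝒫 =
      let x , x∈ , x𝒫 = find some𝒫
      in 𝒩-intro (W ⊕ X) (lose (∈-options-⊕ʳ W X x∈) (trans (All.lookup ih x∈) x𝒫))

OptionClosed : (Game → Set ℓ) → Set ℓ
OptionClosed 𝒜 = ∀ G → 𝒜 G → ∀ G′ → G′ ∈ options G → 𝒜 G′

star-follower : {𝒜 : Game → Set ℓ} → OptionClosed 𝒜 →
  ∀ G → 𝒜 G → G ≢ 𝟘 → ∃[ O ] 𝒜 O × IsStar O
star-follower {𝒜 = 𝒜} closed = Game-induction Has-star step
  where
  Has-star : Game → Set _
  Has-star G = 𝒜 G → G ≢ 𝟘 → ∃[ O ] 𝒜 O × IsStar O

  𝟘-option-of-nonzero : G ≢ 𝟘 → All (_≡ 𝟘) (options G) → 𝟘 ∈ options G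
  𝟘-option-of-nonzero {mk []}      G≢𝟘 _          = ⊥-elim (G≢𝟘 refl)
  𝟘-option-of-nonzero {mk (_ ∷ _)} _   (g≡𝟘 ∷ _) = here (sym g≡𝟘)

  step : ∀ G → All Has-star (options G) → Has-star G
  step G ih 𝒜G G≢𝟘 with All.all? _≟𝟘 (options G)
  ... | yes all𝟘 = G , 𝒜G , record { 𝟘-option = 𝟘-option-of-nonzero G≢𝟘 all𝟘 ; options-𝟘 = all𝟘 }
  ... | no ¬all𝟘 =
    let g , g∈ , g≢𝟘 = find (¬All⇒Any¬ _≟𝟘 _ ¬all𝟘)
    in All.lookup ih g∈ (closed G 𝒜G g g∈) g≢𝟘

proposition4p2 : {ℓ : Level} (𝒜 : Game → Set ℓ) → Closed 𝒜 → NonTrivial 𝒜 →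
    Σ Game λ G → 𝒜 G × ¬ (G ≡[ 𝒜 ] 𝟘) × ((G ⊕ G) ≡[ 𝒜 ] 𝟘)
proposition4p2 𝒜 closed (G , 𝒜G , G≢𝟘)
  with star-follower (Closed.option-closed closed) G 𝒜G G≢𝟘
... | O , 𝒜O , ⋆ = O , 𝒜O , O≢𝟘 , O⊕O≡𝟘
  where
  open ≡-Reasoning

  𝒜𝟘 : 𝒜 𝟘
  𝒜𝟘 = Closed.option-closed closed O 𝒜O 𝟘 (𝟘-option ⋆)

  O≢𝟘 : ¬ (O ≡[ 𝒜 ] 𝟘)
  O≢𝟘 O≡𝟘 with () ← begin
    𝒫             ≡⟨ sym (star-𝒫 ⋆) ⟩
    o⁻ O          ≡⟨ cong o⁻ (sym (⊕-identityʳ O)) ⟩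
    o⁻ (O ⊕ 𝟘)    ≡⟨ O≡𝟘 𝟘 𝒜𝟘 ⟩
    o⁻ (𝟘 ⊕ 𝟘)    ∎

  O⊕O≡𝟘 : (O ⊕ O) ≡[ 𝒜 ] 𝟘
  O⊕O≡𝟘 X _ = trans (star⊕star-cancel ⋆ X) (cong o⁻ (sym (⊕-identityˡ X)))
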